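{- For every $n\in\mathbb{N}_0$ we have $\overline{n+1}-\overline{n}=\varphi^{ -|n|}$.
   Context: Let $\varphi=(1+\sqrt5)/2$. Let $F_0=0$, $F_1=1$, $F_k=F_{k-1}+F_{k-2}$ for $k\ge2$, and write $F^m:=F_{m+2}$ for integers $m\ge-2$. Every $n\in\mathbb{N}_0$ has a unique (Zeckendorf) expansion $n=\sum_{j\ge0}d_jF^j$ with $d_j\in\{0,1\}$, only finitely many nonzero, and no two consecutive digits both equal to $1$. For such $n$ put $\overline{n}:=\sum_{j\ge0}d_j\varphi^j$ and $|n|:=d_0$ (the last digit). -}

module Defs where

open import Data.Nat using (ℕ; zero; suc) renaming (_+_ to _+ℕ_; _*_ to _*ℕ_)
open import Data.Integer using (ℤ; +_; 1ℤ; 0ℤ) renaming (_+_ to _+ℤ_; _*_ to _*ℤ_; -_ to -ℤ_; _-_ to _-ℤ_)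
open import Data.Bool using (Bool; true; false)
open import Data.List using (List; []; _∷_)
open import Data.Product using (_×_)
open import Data.Unit using (⊤)
open import Data.Empty using (⊥)
open import Relation.Binary.PropositionalEquality using (_≡_)

fib : ℕ → ℕ
fib zero = 0
fib (suc zero) = 1
fib (suc (suc k)) = fib (suc k) +ℕ fib k

F^ : ℕ → ℕ
F^ m = fib (suc (suc m))

-- Digit strings, little-endian: the list d₀ ∷ d₁ ∷ d₂ ∷ … represents
-- the digits (d_j)_{j ≥ 0}, all later digits being 0.

Digits : Set
Digits = List Bool

bit : Bool → ℕ
bit true = 1
bit false = 0

NoConsecOnes : Digits → Set
NoConsecOnes [] = ⊤
NoConsecOnes (_ ∷ []) = ⊤
NoConsecOnes (true ∷ true ∷ ds) = ⊥
NoConsecOnes (_ ∷ d ∷ ds) = NoConsecOnes (d ∷ ds)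

valueFrom : ℕ → Digits → ℕ
valueFrom j [] = 0
valueFrom j (d ∷ ds) = bit d *ℕ F^ j +ℕ valueFrom (suc j) ds

value : Digits → ℕ
value = valueFrom 0

IsZeckendorf : ℕ → Digits → Set
IsZeckendorf n ds = NoConsecOnes ds × value ds ≡ n

-- The ring ℤ[φ] ⊂ ℝ, φ = (1+√5)/2.  Since 1, φ are linearly independent
-- over ℚ, every element is uniquely  a + b φ  with a b ∈ ℤ, so equality
-- of real numbers in ℤ[φ] is equality of coefficient pairs.
-- Multiplication uses φ² = φ + 1.

record ℤφ : Set where
  constructor _+_φ
  field
    re : ℤ
    im : ℤ

open ℤφ public

_⊕_ : ℤφ → ℤφ → ℤφ
(a + b φ) ⊕ (c + d φ) = (a +ℤ c) + (b +ℤ d) φ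

_⊖_ : ℤφ → ℤφ → ℤφ
(a + b φ) ⊖ (c + d φ) = (a -ℤ c) + (b -ℤ d) φ

_⊗_ : ℤφ → ℤφ → ℤφ
(a + b φ) ⊗ (c + d φ) = ((a *ℤ c) +ℤ (b *ℤ d)) + ((a *ℤ d) +ℤ (b *ℤ c) +ℤ (b *ℤ d)) φ

oneφ : ℤφ
oneφ = 1ℤ + 0ℤ φ

zeroφ : ℤφ
zeroφ = 0ℤ + 0ℤ φ

φ : ℤφ
φ = 0ℤ + 1ℤ φ

-- φ⁻¹ = φ - 1  (since φ(φ - 1) = φ² - φ = 1)
φ⁻¹ : ℤφ
φ⁻¹ = (-ℤ 1ℤ) + 1ℤ φ

_^φ_ : ℤφ → ℕ → ℤφ
x ^φ zero = oneφ
x ^φ suc k = x ⊗ (x ^φ k)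

bitφ : Bool → ℤφ
bitφ true = oneφ
bitφ false = zeroφ

barFrom : ℕ → Digits → ℤφ
barFrom j [] = zeroφ
barFrom j (d ∷ ds) = (bitφ d ⊗ (φ ^φ j)) ⊕ barFrom (suc j) ds

bar : Digits → ℤφ
bar = barFrom 0

-- |n| = d₀, the last (lowest) digit
lastDigit : Digits → ℕ
lastDigit [] = 0
lastDigit (d ∷ _) = bit d

-- Adding 1 to a Zeckendorf expansion only changes its lowest digits: if d₀ = 0
-- a digit 1 is put at position 0, if d₀ = 1 it is moved to position 1
-- (1 + F^0 = F^1); any carry this causes rewrites two adjacent ones at
-- positions j, j+1 as a single one at j+2.  The powers φ^j obey the same
-- recurrence φ^{j+2} = φ^j + φ^{j+1} as the F^j, so carries leave the
-- φ-evaluation unchanged, and it grows by φ^0 = 1, resp. by φ − 1 = φ⁻¹.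
-- Uniqueness of the Zeckendorf expansion (up to trailing zeros), proved from the
-- leading digit down, transfers this to any expansion of n + 1.
module Submission where

open import Defs
open import Data.Nat using (ℕ; suc; zero; _+_; _*_; _≤_; _<_; _≤′_; z≤n; s≤s; ≤′-refl; ≤′-step)
open import Data.Nat.Properties
  using (+-identityʳ; +-suc; +-comm; +-assoc; *-identityˡ; +-cancelʳ-≡; m≤m+n; m≤n+m;
         +-monoˡ-≤; ≤-refl; module ≤-Reasoning; ≤-trans; ≤-reflexive; ≤-antisym; ≤⇒≤′; _≤?_; ≰⇒>; <⇒≱)
open import Data.Integer using (0ℤ; 1ℤ) renaming (_+_ to _+ℤ_; _*_ to _*ℤ_; _-_ to _-ℤ_)
import Data.Integer.Properties as ℤ
open import Data.Integer.Tactic.RingSolver using (solve-∀)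
open import Data.Bool using (true; false)
open import Data.List using ([]; _∷_; _∷ʳ_; length)
open import Data.List.Properties using (length-++)
open import Data.List.Reverse using (Reverse; []; _∶_∶ʳ_; reverseView)
open import Data.Product using (_,_)
open import Data.Unit using (tt)
open import Data.Empty using (⊥-elim)
open import Relation.Nullary using (yes; no)
open import Relation.Binary.PropositionalEquality
  using (_≡_; _≢_; refl; sym; trans; cong; cong₂; module ≡-Reasoning)

⊕-identityˡ : ∀ x → zeroφ ⊕ x ≡ x
⊕-identityˡ (a + b φ) = cong₂ _+_φ (ℤ.+-identityˡ a) (ℤ.+-identityˡ b)

⊕-identityʳ : ∀ x → x ⊕ zeroφ ≡ x
⊕-identityʳ (a + b φ) = cong₂ _+_φ (ℤ.+-identityʳ a) (ℤ.+-identityʳ b)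

⊕-assoc : ∀ x y z → (x ⊕ y) ⊕ z ≡ x ⊕ (y ⊕ z)
⊕-assoc (a + b φ) (c + d φ) (e + f φ) = cong₂ _+_φ (ℤ.+-assoc a c e) (ℤ.+-assoc b d f)

⊕-⊖-cancelʳ : ∀ x y → (x ⊕ y) ⊖ y ≡ x
⊕-⊖-cancelʳ (a + b φ) (c + d φ) = cong₂ _+_φ (+-−-cancelʳ a c) (+-−-cancelʳ b d)
  where
  +-−-cancelʳ : ∀ i j → (i +ℤ j) -ℤ j ≡ i
  +-−-cancelʳ = solve-∀

⊗-identityˡ : ∀ x → oneφ ⊗ x ≡ x
⊗-identityˡ (a + b φ) = cong₂ _+_φ (re-identity a b) (im-identity a b)
  where
  re-identity : ∀ a b → 1ℤ *ℤ a +ℤ 0ℤ *ℤ b ≡ a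
  re-identity = solve-∀
  im-identity : ∀ a b → 1ℤ *ℤ b +ℤ 0ℤ *ℤ a +ℤ 0ℤ *ℤ b ≡ b
  im-identity = solve-∀

-- The solver needs the components of ⊗ spelled out as in Defs.
φ²≡1+φ : ∀ x → φ ⊗ (φ ⊗ x) ≡ x ⊕ (φ ⊗ x)
φ²≡1+φ (a + b φ) = cong₂ _+_φ (re-φ² a b) (im-φ² a b)
  where
  re-φ² : ∀ a b → 0ℤ *ℤ (0ℤ *ℤ a +ℤ 1ℤ *ℤ b) +ℤ 1ℤ *ℤ (0ℤ *ℤ b +ℤ 1ℤ *ℤ a +ℤ 1ℤ *ℤ b)
                ≡ a +ℤ (0ℤ *ℤ a +ℤ 1ℤ *ℤ b)
  re-φ² = solve-∀
  im-φ² : ∀ a b → 0ℤ *ℤ (0ℤ *ℤ b +ℤ 1ℤ *ℤ a +ℤ 1ℤ *ℤ b) +ℤ 1ℤ *ℤ (0ℤ *ℤ a +ℤ 1ℤ *ℤ b)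
                    +ℤ 1ℤ *ℤ (0ℤ *ℤ b +ℤ 1ℤ *ℤ a +ℤ 1ℤ *ℤ b)
                ≡ b +ℤ (0ℤ *ℤ b +ℤ 1ℤ *ℤ a +ℤ 1ℤ *ℤ b)
  im-φ² = solve-∀

φ^-recurrence : ∀ j x → (φ ^φ suc (suc j)) ⊕ x ≡ (φ ^φ j) ⊕ ((φ ^φ suc j) ⊕ x)
φ^-recurrence j x = begin
  (φ ⊗ (φ ⊗ P)) ⊕ x     ≡⟨ cong (_⊕ x) (φ²≡1+φ P) ⟩
  (P ⊕ (φ ⊗ P)) ⊕ x     ≡⟨ ⊕-assoc P (φ ⊗ P) x ⟩
  P ⊕ ((φ ⊗ P) ⊕ x)     ∎
  where
  open ≡-Reasoning
  P = φ ^φ j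

F^-recurrence : ∀ j x → F^ (suc (suc j)) + x ≡ F^ j + (F^ (suc j) + x)
F^-recurrence j x = begin
  (F^ (suc j) + F^ j) + x   ≡⟨ cong (_+ x) (+-comm (F^ (suc j)) (F^ j)) ⟩
  (F^ j + F^ (suc j)) + x   ≡⟨ +-assoc (F^ j) (F^ (suc j)) x ⟩
  F^ j + (F^ (suc j) + x)   ∎
  where open ≡-Reasoning

fib-≤-suc : ∀ n → fib n ≤ fib (suc n)
fib-≤-suc zero    = z≤n
fib-≤-suc (suc n) = m≤m+n (fib (suc n)) (fib n)

fib-mono-≤ : ∀ {m n} → m ≤ n → fib m ≤ fib n
fib-mono-≤ m≤n = go (≤⇒≤′ m≤n)
  where
  go : ∀ {m n} → m ≤′ n → fib m ≤ fib n
  go ≤′-refl           = ≤-refl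
  go (≤′-step {n} m≤n) = ≤-trans (go m≤n) (fib-≤-suc n)

F^-mono-≤ : ∀ {m n} → m ≤ n → F^ m ≤ F^ n
F^-mono-≤ m≤n = fib-mono-≤ (s≤s (s≤s m≤n))

F^m≤n<F^1+k⇒m≤k : ∀ {m n k} → F^ m ≤ n → n < F^ (suc k) → m ≤ k
F^m≤n<F^1+k⇒m≤k {m} {n} {k} F^m≤n n<F^1+k with m ≤? k
... | yes m≤k = m≤k
... | no  m≰k = ⊥-elim (<⇒≱ n<F^1+k (≤-trans (F^-mono-≤ (≰⇒> m≰k)) F^m≤n))

NoConsecOnes-tail : ∀ d ds → NoConsecOnes (d ∷ ds) → NoConsecOnes ds
NoConsecOnes-tail d     []           _  = tt
NoConsecOnes-tail true  (true ∷ ds)  ()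
NoConsecOnes-tail true  (false ∷ ds) v  = v
NoConsecOnes-tail false (e ∷ ds)     v  = v

NoConsecOnes-false∷ : ∀ ds → NoConsecOnes ds → NoConsecOnes (false ∷ ds)
NoConsecOnes-false∷ []       _ = tt
NoConsecOnes-false∷ (d ∷ ds) v = v

NoConsecOnes-init : ∀ xs x → NoConsecOnes (xs ∷ʳ x) → NoConsecOnes xs
NoConsecOnes-init []                  x _  = tt
NoConsecOnes-init (d ∷ [])            x _  = tt
NoConsecOnes-init (true ∷ true ∷ xs)  x ()
NoConsecOnes-init (true ∷ false ∷ xs) x v  = NoConsecOnes-init (false ∷ xs) x v
NoConsecOnes-init (false ∷ e ∷ xs)    x v  = NoConsecOnes-init (e ∷ xs) x v

valueFrom-true : ∀ j ds → valueFrom j (true ∷ ds) ≡ F^ j + valueFrom (suc j) ds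
valueFrom-true j ds = cong (_+ valueFrom (suc j) ds) (*-identityˡ (F^ j))

barFrom-true : ∀ j ds → barFrom j (true ∷ ds) ≡ (φ ^φ j) ⊕ barFrom (suc j) ds
barFrom-true j ds = cong (_⊕ barFrom (suc j) ds) (⊗-identityˡ (φ ^φ j))

barFrom-false : ∀ j ds → barFrom j (false ∷ ds) ≡ barFrom (suc j) ds
barFrom-false j ds = ⊕-identityˡ (barFrom (suc j) ds)

prependOne : Digits → Digits
prependOne []                 = true ∷ []
prependOne (false ∷ ds)       = true ∷ false ∷ ds
prependOne (true ∷ [])        = false ∷ false ∷ prependOne []
prependOne (true ∷ false ∷ ds) = false ∷ false ∷ prependOne ds
prependOne (true ∷ true ∷ _)  = []

increment : Digits → Digits
increment []                 = prependOne []
increment (false ∷ ds)       = prependOne ds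
increment (true ∷ [])        = false ∷ prependOne []
increment (true ∷ false ∷ ds) = false ∷ prependOne ds
increment (true ∷ true ∷ _)  = []

prependOne-NoConsecOnes : ∀ ds → NoConsecOnes ds → NoConsecOnes (prependOne ds)
prependOne-NoConsecOnes []                 _ = tt
prependOne-NoConsecOnes (false ∷ ds)       v = v
prependOne-NoConsecOnes (true ∷ [])        _ = tt
prependOne-NoConsecOnes (true ∷ false ∷ ds) v =
  NoConsecOnes-false∷ (prependOne ds) (prependOne-NoConsecOnes ds (NoConsecOnes-tail false ds v))

increment-NoConsecOnes : ∀ ds → NoConsecOnes ds → NoConsecOnes (increment ds)
increment-NoConsecOnes []                 _ = tt
increment-NoConsecOnes (false ∷ ds)       v = prependOne-NoConsecOnes ds (NoConsecOnes-tail false ds v)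
increment-NoConsecOnes (true ∷ [])        _ = tt
increment-NoConsecOnes (true ∷ false ∷ ds) v =
  NoConsecOnes-false∷ (prependOne ds) (prependOne-NoConsecOnes ds (NoConsecOnes-tail false ds v))

valueFrom-prependOne : ∀ j ds → NoConsecOnes ds →
                       valueFrom j (prependOne ds) ≡ F^ j + valueFrom (suc j) ds
valueFrom-prependOne j []                 _ = valueFrom-true j []
valueFrom-prependOne j (false ∷ ds)       _ = valueFrom-true j (false ∷ ds)
valueFrom-prependOne j (true ∷ [])        _ = begin
  valueFrom (2 + j) (prependOne [])     ≡⟨ valueFrom-true (2 + j) [] ⟩
  F^ (2 + j) + 0                        ≡⟨ F^-recurrence j 0 ⟩
  F^ j + (F^ (1 + j) + 0)               ≡⟨ cong (F^ j +_) (valueFrom-true (1 + j) []) ⟨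
  F^ j + valueFrom (1 + j) (true ∷ [])  ∎
  where open ≡-Reasoning
valueFrom-prependOne j (true ∷ false ∷ ds) v = begin
  valueFrom (2 + j) (prependOne ds)               ≡⟨ valueFrom-prependOne (2 + j) ds (NoConsecOnes-tail false ds v) ⟩
  F^ (2 + j) + valueFrom (3 + j) ds               ≡⟨ F^-recurrence j _ ⟩
  F^ j + (F^ (1 + j) + valueFrom (3 + j) ds)      ≡⟨ cong (F^ j +_) (valueFrom-true (1 + j) (false ∷ ds)) ⟨
  F^ j + valueFrom (1 + j) (true ∷ false ∷ ds)    ∎
  where open ≡-Reasoning

barFrom-false-false : ∀ j ds → barFrom j (false ∷ false ∷ ds) ≡ barFrom (2 + j) ds
barFrom-false-false j ds = trans (barFrom-false j (false ∷ ds)) (barFrom-false (1 + j) ds)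

barFrom-true-false : ∀ j ds → barFrom j (true ∷ false ∷ ds) ≡ (φ ^φ j) ⊕ barFrom (2 + j) ds
barFrom-true-false j ds = trans (barFrom-true j (false ∷ ds)) (cong ((φ ^φ j) ⊕_) (barFrom-false (1 + j) ds))

barFrom-prependOne : ∀ j ds → NoConsecOnes ds →
                     barFrom j (prependOne ds) ≡ (φ ^φ j) ⊕ barFrom (suc j) ds
barFrom-prependOne j []                 _ = barFrom-true j []
barFrom-prependOne j (false ∷ ds)       _ = barFrom-true j (false ∷ ds)
barFrom-prependOne j (true ∷ [])        _ = begin
  barFrom j (false ∷ false ∷ prependOne [])         ≡⟨ barFrom-false-false j (prependOne []) ⟩
  barFrom (2 + j) (prependOne [])                   ≡⟨ barFrom-true (2 + j) [] ⟩
  (φ ^φ (2 + j)) ⊕ zeroφ                            ≡⟨ φ^-recurrence j zeroφ ⟩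
  (φ ^φ j) ⊕ ((φ ^φ (1 + j)) ⊕ zeroφ)               ≡⟨ cong ((φ ^φ j) ⊕_) (barFrom-true (1 + j) []) ⟨
  (φ ^φ j) ⊕ barFrom (1 + j) (true ∷ [])            ∎
  where open ≡-Reasoning
barFrom-prependOne j (true ∷ false ∷ ds) v = begin
  barFrom j (false ∷ false ∷ prependOne ds)         ≡⟨ barFrom-false-false j (prependOne ds) ⟩
  barFrom (2 + j) (prependOne ds)                   ≡⟨ barFrom-prependOne (2 + j) ds (NoConsecOnes-tail false ds v) ⟩
  (φ ^φ (2 + j)) ⊕ barFrom (3 + j) ds               ≡⟨ φ^-recurrence j _ ⟩
  (φ ^φ j) ⊕ ((φ ^φ (1 + j)) ⊕ barFrom (3 + j) ds)  ≡⟨ cong ((φ ^φ j) ⊕_) (barFrom-true-false (1 + j) ds) ⟨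
  (φ ^φ j) ⊕ barFrom (1 + j) (true ∷ false ∷ ds)    ∎
  where open ≡-Reasoning

value-increment : ∀ ds → NoConsecOnes ds → value (increment ds) ≡ suc (value ds)
value-increment []                  _ = refl
value-increment (false ∷ ds)        v = valueFrom-prependOne 0 ds (NoConsecOnes-tail false ds v)
value-increment (true ∷ [])         _ = refl
value-increment (true ∷ false ∷ ds) v = valueFrom-prependOne 1 ds (NoConsecOnes-tail false ds v)

bar-increment : ∀ ds → NoConsecOnes ds → bar (increment ds) ≡ (φ⁻¹ ^φ lastDigit ds) ⊕ bar ds
bar-increment []                  _ = refl
bar-increment (false ∷ ds)        v = begin
  bar (prependOne ds)          ≡⟨ barFrom-prependOne 0 ds (NoConsecOnes-tail false ds v) ⟩
  oneφ ⊕ barFrom 1 ds          ≡⟨ cong (oneφ ⊕_) (barFrom-false 0 ds) ⟨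
  oneφ ⊕ bar (false ∷ ds)      ∎
  where open ≡-Reasoning
bar-increment (true ∷ [])         _ = refl
bar-increment (true ∷ false ∷ ds) v = begin
  bar (false ∷ prependOne ds)               ≡⟨ barFrom-false 0 (prependOne ds) ⟩
  barFrom 1 (prependOne ds)                 ≡⟨ barFrom-prependOne 1 ds (NoConsecOnes-tail false ds v) ⟩
  φ ⊕ barFrom 2 ds                          ≡⟨⟩  -- φ = φ⁻¹ + 1, by evaluation in ℤ[φ]
  ((φ⁻¹ ⊗ oneφ) ⊕ oneφ) ⊕ barFrom 2 ds      ≡⟨ ⊕-assoc (φ⁻¹ ⊗ oneφ) oneφ (barFrom 2 ds) ⟩
  (φ⁻¹ ⊗ oneφ) ⊕ (oneφ ⊕ barFrom 2 ds)      ≡⟨ cong ((φ⁻¹ ⊗ oneφ) ⊕_) (barFrom-true-false 0 ds) ⟨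
  (φ⁻¹ ⊗ oneφ) ⊕ bar (true ∷ false ∷ ds)    ∎
  where open ≡-Reasoning

valueFrom-∷ʳ : ∀ j xs x → valueFrom j (xs ∷ʳ x) ≡ valueFrom j xs + bit x * F^ (j + length xs)
valueFrom-∷ʳ j []       x = trans (+-identityʳ _) (cong (λ k → bit x * F^ k) (sym (+-identityʳ j)))
valueFrom-∷ʳ j (d ∷ xs) x = begin
  bit d * F^ j + valueFrom (suc j) (xs ∷ʳ x)
    ≡⟨ cong (bit d * F^ j +_) (valueFrom-∷ʳ (suc j) xs x) ⟩
  bit d * F^ j + (valueFrom (suc j) xs + bit x * F^ (suc j + length xs))
    ≡⟨ +-assoc (bit d * F^ j) (valueFrom (suc j) xs) _ ⟨
  valueFrom j (d ∷ xs) + bit x * F^ (suc j + length xs)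
    ≡⟨ cong (λ k → valueFrom j (d ∷ xs) + bit x * F^ k) (+-suc j (length xs)) ⟨
  valueFrom j (d ∷ xs) + bit x * F^ (j + suc (length xs))
    ∎
  where open ≡-Reasoning

barFrom-∷ʳ : ∀ j xs x → barFrom j (xs ∷ʳ x) ≡ barFrom j xs ⊕ (bitφ x ⊗ (φ ^φ (j + length xs)))
barFrom-∷ʳ j []       x = begin
  (bitφ x ⊗ (φ ^φ j)) ⊕ zeroφ          ≡⟨ ⊕-identityʳ _ ⟩
  bitφ x ⊗ (φ ^φ j)                    ≡⟨ cong (λ k → bitφ x ⊗ (φ ^φ k)) (+-identityʳ j) ⟨
  bitφ x ⊗ (φ ^φ (j + 0))              ≡⟨ ⊕-identityˡ _ ⟨
  zeroφ ⊕ (bitφ x ⊗ (φ ^φ (j + 0)))    ∎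
  where open ≡-Reasoning
barFrom-∷ʳ j (d ∷ xs) x = begin
  D ⊕ barFrom (suc j) (xs ∷ʳ x)
    ≡⟨ cong (D ⊕_) (barFrom-∷ʳ (suc j) xs x) ⟩
  D ⊕ (barFrom (suc j) xs ⊕ (bitφ x ⊗ (φ ^φ (suc j + length xs))))
    ≡⟨ ⊕-assoc D (barFrom (suc j) xs) _ ⟨
  barFrom j (d ∷ xs) ⊕ (bitφ x ⊗ (φ ^φ (suc j + length xs)))
    ≡⟨ cong (λ k → barFrom j (d ∷ xs) ⊕ (bitφ x ⊗ (φ ^φ k))) (+-suc j (length xs)) ⟨
  barFrom j (d ∷ xs) ⊕ (bitφ x ⊗ (φ ^φ (j + suc (length xs))))
    ∎
  where
  open ≡-Reasoning
  D = bitφ d ⊗ (φ ^φ j)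

value-∷ʳ-false : ∀ xs → value (xs ∷ʳ false) ≡ value xs
value-∷ʳ-false xs = trans (valueFrom-∷ʳ 0 xs false) (+-identityʳ (value xs))

value-∷ʳ-true : ∀ xs → value (xs ∷ʳ true) ≡ value xs + F^ (length xs)
value-∷ʳ-true xs = trans (valueFrom-∷ʳ 0 xs true) (cong (value xs +_) (*-identityˡ (F^ (length xs))))

bar-∷ʳ-false : ∀ xs → bar (xs ∷ʳ false) ≡ bar xs
bar-∷ʳ-false xs = trans (barFrom-∷ʳ 0 xs false) (⊕-identityʳ (bar xs))

bar-∷ʳ-true : ∀ xs → bar (xs ∷ʳ true) ≡ bar xs ⊕ (φ ^φ length xs)
bar-∷ʳ-true xs = trans (barFrom-∷ʳ 0 xs true) (cong (bar xs ⊕_) (⊗-identityˡ (φ ^φ length xs)))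

fib+valueFrom-true : ∀ j ds → fib (suc j) + valueFrom j (true ∷ ds) ≡ F^ (suc j) + valueFrom (suc j) ds
fib+valueFrom-true j ds = begin
  fib (suc j) + valueFrom j (true ∷ ds)      ≡⟨ cong (fib (suc j) +_) (valueFrom-true j ds) ⟩
  fib (suc j) + (F^ j + valueFrom (suc j) ds) ≡⟨ +-assoc (fib (suc j)) (F^ j) _ ⟨
  (fib (suc j) + F^ j) + valueFrom (suc j) ds ≡⟨ cong (_+ valueFrom (suc j) ds) (+-comm (fib (suc j)) (F^ j)) ⟩
  F^ (suc j) + valueFrom (suc j) ds           ∎
  where open ≡-Reasoning

-- The extra F_{j+1} makes the induction close, as F_{j+1} + F^j = F^{j+1}.
valueFrom-bound : ∀ j ds → NoConsecOnes ds → fib (suc j) + valueFrom j ds ≤ F^ (j + length ds)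
valueFrom-bound j [] _ = begin
  fib (suc j) + 0   ≡⟨ +-identityʳ (fib (suc j)) ⟩
  fib (suc j)       ≤⟨ fib-≤-suc (suc j) ⟩
  F^ j              ≡⟨ cong F^ (+-identityʳ j) ⟨
  F^ (j + 0)        ∎
  where open ≤-Reasoning
valueFrom-bound j (false ∷ ds) v = begin
  fib (suc j) + valueFrom (suc j) ds        ≤⟨ +-monoˡ-≤ (valueFrom (suc j) ds) (fib-≤-suc (suc j)) ⟩
  fib (2 + j) + valueFrom (suc j) ds        ≤⟨ valueFrom-bound (suc j) ds (NoConsecOnes-tail false ds v) ⟩
  F^ (suc j + length ds)                    ≡⟨ cong F^ (+-suc j (length ds)) ⟨
  F^ (j + suc (length ds))                  ∎
  where open ≤-Reasoning
valueFrom-bound j (true ∷ []) _ = begin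
  fib (suc j) + valueFrom j (true ∷ [])     ≡⟨ fib+valueFrom-true j [] ⟩
  F^ (suc j) + 0                            ≡⟨ +-identityʳ (F^ (suc j)) ⟩
  F^ (suc j)                                ≡⟨ cong F^ (+-comm 1 j) ⟩
  F^ (j + 1)                                ∎
  where open ≤-Reasoning
valueFrom-bound j (true ∷ false ∷ ds) v = begin
  fib (suc j) + valueFrom j (true ∷ false ∷ ds)  ≡⟨ fib+valueFrom-true j (false ∷ ds) ⟩
  fib (3 + j) + valueFrom (2 + j) ds             ≤⟨ valueFrom-bound (2 + j) ds (NoConsecOnes-tail false ds v) ⟩
  F^ (2 + j + length ds)                         ≡⟨ cong F^ (trans (+-suc j (suc (length ds))) (cong suc (+-suc j (length ds)))) ⟨
  F^ (j + (2 + length ds))                       ∎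
  where open ≤-Reasoning

value<F^length : ∀ ds → NoConsecOnes ds → value ds < F^ (length ds)
value<F^length = valueFrom-bound 0

F^length≤value-∷ʳ-true : ∀ xs → F^ (length xs) ≤ value (xs ∷ʳ true)
F^length≤value-∷ʳ-true xs = ≤-trans (m≤n+m (F^ (length xs)) (value xs)) (≤-reflexive (sym (value-∷ʳ-true xs)))

value-∷ʳ-true<F^ : ∀ xs → NoConsecOnes (xs ∷ʳ true) → value (xs ∷ʳ true) < F^ (suc (length xs))
value-∷ʳ-true<F^ xs v =
  ≤-trans (value<F^length (xs ∷ʳ true) v) (≤-reflexive (cong F^ (trans (length-++ xs) (+-comm (length xs) 1))))

leadingDigit-position-unique : ∀ xs ys → NoConsecOnes (xs ∷ʳ true) → NoConsecOnes (ys ∷ʳ true) →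
                               value (xs ∷ʳ true) ≡ value (ys ∷ʳ true) → length xs ≡ length ys
leadingDigit-position-unique xs ys vx vy eq = ≤-antisym
  (F^m≤n<F^1+k⇒m≤k (≤-trans (F^length≤value-∷ʳ-true xs) (≤-reflexive eq)) (value-∷ʳ-true<F^ ys vy))
  (F^m≤n<F^1+k⇒m≤k (≤-trans (F^length≤value-∷ʳ-true ys) (≤-reflexive (sym eq))) (value-∷ʳ-true<F^ xs vx))

value-∷ʳ-true≢0 : ∀ xs → value (xs ∷ʳ true) ≢ 0
value-∷ʳ-true≢0 xs eq with ≤-trans (F^-mono-≤ {n = length xs} z≤n) (≤-trans (F^length≤value-∷ʳ-true xs) (≤-reflexive eq))
... | ()

bar-unique : ∀ {ds es} → Reverse ds → Reverse es → NoConsecOnes ds → NoConsecOnes es →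
             value ds ≡ value es → bar ds ≡ bar es
bar-unique [] [] _ _ _ = refl
bar-unique (xs ∶ rxs ∶ʳ false) res vd ve eq = begin
  bar (xs ∷ʳ false)   ≡⟨ bar-∷ʳ-false xs ⟩
  bar xs              ≡⟨ bar-unique rxs res (NoConsecOnes-init xs false vd) ve (trans (sym (value-∷ʳ-false xs)) eq) ⟩
  bar _               ∎
  where open ≡-Reasoning
bar-unique rds (ys ∶ rys ∶ʳ false) vd ve eq = begin
  bar _               ≡⟨ bar-unique rds rys vd (NoConsecOnes-init ys false ve) (trans eq (value-∷ʳ-false ys)) ⟩
  bar ys              ≡⟨ bar-∷ʳ-false ys ⟨
  bar (ys ∷ʳ false)   ∎
  where open ≡-Reasoning
bar-unique [] (ys ∶ _ ∶ʳ true) _ _ eq = ⊥-elim (value-∷ʳ-true≢0 ys (sym eq))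
bar-unique (xs ∶ _ ∶ʳ true) [] _ _ eq = ⊥-elim (value-∷ʳ-true≢0 xs eq)
bar-unique (xs ∶ rxs ∶ʳ true) (ys ∶ rys ∶ʳ true) vd ve eq = begin
  bar (xs ∷ʳ true)                 ≡⟨ bar-∷ʳ-true xs ⟩
  bar xs ⊕ (φ ^φ length xs)        ≡⟨ cong₂ (λ b l → b ⊕ (φ ^φ l)) bar-xs≡bar-ys same-length ⟩
  bar ys ⊕ (φ ^φ length ys)        ≡⟨ bar-∷ʳ-true ys ⟨
  bar (ys ∷ʳ true)                 ∎
  where
  open ≡-Reasoning
  same-length : length xs ≡ length ys
  same-length = leadingDigit-position-unique xs ys vd ve eq
  value-xs≡value-ys : value xs ≡ value ys
  value-xs≡value-ys = +-cancelʳ-≡ (F^ (length ys)) (value xs) (value ys) (begin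
    value xs + F^ (length ys)    ≡⟨ cong (λ l → value xs + F^ l) same-length ⟨
    value xs + F^ (length xs)    ≡⟨ value-∷ʳ-true xs ⟨
    value (xs ∷ʳ true)           ≡⟨ eq ⟩
    value (ys ∷ʳ true)           ≡⟨ value-∷ʳ-true ys ⟩
    value ys + F^ (length ys)    ∎)
  bar-xs≡bar-ys : bar xs ≡ bar ys
  bar-xs≡bar-ys = bar-unique rxs rys (NoConsecOnes-init xs true vd) (NoConsecOnes-init ys true ve) value-xs≡value-ys

value≡⇒bar≡ : ∀ {ds es} → NoConsecOnes ds → NoConsecOnes es → value ds ≡ value es → bar ds ≡ bar es
value≡⇒bar≡ {ds} {es} = bar-unique (reverseView ds) (reverseView es)

lemma2p3 : (n : ℕ) (ds es : Digits) → IsZeckendorf n ds → IsZeckendorf (suc n) es →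
           bar es ⊖ bar ds ≡ φ⁻¹ ^φ lastDigit ds
lemma2p3 n ds es (ds-valid , refl) (es-valid , value-es) = begin
  bar es ⊖ bar ds                                  ≡⟨ cong (_⊖ bar ds) bar-es≡bar-increment ⟩
  bar (increment ds) ⊖ bar ds                      ≡⟨ cong (_⊖ bar ds) (bar-increment ds ds-valid) ⟩
  ((φ⁻¹ ^φ lastDigit ds) ⊕ bar ds) ⊖ bar ds        ≡⟨ ⊕-⊖-cancelʳ (φ⁻¹ ^φ lastDigit ds) (bar ds) ⟩
  φ⁻¹ ^φ lastDigit ds                              ∎
  where
  open ≡-Reasoning
  bar-es≡bar-increment : bar es ≡ bar (increment ds)
  bar-es≡bar-increment = value≡⇒bar≡ es-valid (increment-NoConsecOnes ds ds-valid)
    (trans value-es (sym (value-increment ds ds-valid)))
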